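{- For every monadic second-order structure $\mathfrak A$, every subset $X$ of its universe, and all $d,m\in\{0,1,\dots\}$, the number of distinct rows of the matrix $M_{d+1,m}$ is at most $2^{N}$, where $N$ is the number of distinct rows of the matrix $M_{d,m+1}$.
   Context: A monadic second-order structure is a finite universe with relations all of whose arguments are subsets of the universe. The $d$-type of a tuple of subsets is the set of MSO formulas of quantifier depth at most $d$ with the corresponding free set variables that hold for the tuple. For a structure $\mathfrak A$, a subset $X$ of its universe and $d,n\ge0$, the matrix $M_{d,n}$ has rows indexed by $n$-tuples $(X_1,\dots,X_n)$ of subsets of $X$, columns indexed by $n$-tuples $(Y_1,\dots,Y_n)$ of subsets of the complement of $X$, and entry at that position the $d$-type of $(X_1\cup Y_1,\dots,X_n\cup Y_n)$ in $\mathfrak A$. Two rows are distinct if they differ in some column. -}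

module Defs where

open import Data.Nat using (ℕ; zero; suc; _≤_; _⊔_)
open import Data.Fin using (Fin)
open import Data.Bool using (Bool; T)
open import Data.Vec using (Vec; lookup; map; zipWith; _∷_)
open import Data.Vec.Relation.Unary.All using (All)
open import Data.Fin.Subset using (Subset; _⊆_; _∪_; ∁)
open import Data.Product using (Σ; _×_; _,_; proj₁)
open import Data.Empty using (⊥)
open import Relation.Nullary using (¬_)
open import Relation.Binary.PropositionalEquality using (_≢_)

record Signature : Set where
  field
    nRel  : ℕ
    arity : Fin nRel → ℕ
open Signature public

record MSOStructure (σ : Signature) : Set where
  field
    size : ℕ
    rel  : (i : Fin (nRel σ)) → Vec (Subset size) (arity σ i) → Bool
open MSOStructure public

-- MSO formulas over σ with m free set variables (de Bruijn, Fin m).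
-- Atoms: R(x₁,…,x_r) and set inclusion x ⊆ y.
data Formula (σ : Signature) (m : ℕ) : Set where
  atom  : (i : Fin (nRel σ)) → Vec (Fin m) (arity σ i) → Formula σ m
  incl  : Fin m → Fin m → Formula σ m
  ¬'_   : Formula σ m → Formula σ m
  _∧'_  : Formula σ m → Formula σ m → Formula σ m
  ∃'_   : Formula σ (suc m) → Formula σ m

qd : ∀ {σ m} → Formula σ m → ℕ
qd (atom i xs) = 0
qd (incl x y)  = 0
qd (¬' φ)      = qd φ
qd (φ ∧' ψ)    = qd φ ⊔ qd ψ
qd (∃' φ)      = suc (qd φ)

-- satisfaction; the new variable of ∃ is variable zero
Sat : ∀ {σ m} (𝔄 : MSOStructure σ) → Formula σ m → Vec (Subset (size 𝔄)) m → Set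
Sat 𝔄 (atom i xs) ρ = T (rel 𝔄 i (map (lookup ρ) xs))
Sat 𝔄 (incl x y)  ρ = lookup ρ x ⊆ lookup ρ y
Sat 𝔄 (¬' φ)      ρ = ¬ Sat 𝔄 φ ρ
Sat 𝔄 (φ ∧' ψ)    ρ = Sat 𝔄 φ ρ × Sat 𝔄 ψ ρ
Sat 𝔄 (∃' φ)      ρ = Σ (Subset (size 𝔄)) λ Z → Sat 𝔄 φ (Z ∷ ρ)

tp : ∀ {σ m} (𝔄 : MSOStructure σ) (d : ℕ) → Vec (Subset (size 𝔄)) m → Formula σ m → Set
tp 𝔄 d ρ φ = (qd φ ≤ d) × Sat 𝔄 φ ρ

_≐_ : ∀ {σ m} → (Formula σ m → Set) → (Formula σ m → Set) → Set
P ≐ Q = ∀ φ → (P φ → Q φ) × (Q φ → P φ)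

-- row and column indices of M_{d,m}
Row : ∀ {σ} (𝔄 : MSOStructure σ) → Subset (size 𝔄) → ℕ → Set
Row 𝔄 X m = Σ (Vec (Subset (size 𝔄)) m) (All (_⊆ X))

Col : ∀ {σ} (𝔄 : MSOStructure σ) → Subset (size 𝔄) → ℕ → Set
Col 𝔄 X m = Σ (Vec (Subset (size 𝔄)) m) (All (_⊆ ∁ X))

entry : ∀ {σ} (𝔄 : MSOStructure σ) (X : Subset (size 𝔄)) (d m : ℕ) →
        Row 𝔄 X m → Col 𝔄 X m → Formula σ m → Set
entry 𝔄 X d m r c = tp 𝔄 d (zipWith _∪_ (proj₁ r) (proj₁ c))

DistinctRows : ∀ {σ} (𝔄 : MSOStructure σ) (X : Subset (size 𝔄)) (d m : ℕ) →
               Row 𝔄 X m → Row 𝔄 X m → Set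
DistinctRows 𝔄 X d m r r' = Σ (Col 𝔄 X m) λ c → ¬ (entry 𝔄 X d m r c ≐ entry 𝔄 X d m r' c)

AtMostDistinctRows : ∀ {σ} (𝔄 : MSOStructure σ) (X : Subset (size 𝔄)) (d m K : ℕ) → Set
AtMostDistinctRows 𝔄 X d m K =
  ∀ (k : ℕ) (f : Fin k → Row 𝔄 X m) →
  (∀ i j → i ≢ j → DistinctRows 𝔄 X d m (f i) (f j)) → k ≤ K

-- Equality of rows of M_{d+1,m} is controlled by which rows of M_{d,m+1} extend them:
-- if the one-column extensions (Z, r) and (Z, r′) of two rows r, r′ (Z ⊆ X) meet the same
-- classes of equal rows of M_{d,m+1}, then an induction on formulas of depth ≤ d+1 shows
-- that r and r′ have the same (d+1)-types in every column; a quantified set Z is split into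
-- Z ∩ X, which extends the row, and Z ∖ X, which extends the column. Distinct rows of
-- M_{d+1,m} therefore meet distinct sets of at most N classes, so there are at most 2^N.
-- Equality of rows quantifies over infinitely many formulas and is not decidable, so the
-- counting takes place in the double-negation monad; the conclusion k ≤ 2^N is decidable.

module Submission where

open import Defs
open import Level using (Level; _⊔_; 0ℓ) renaming (suc to lsuc)
open import Function using (id; _∘_; case_of_)
open import Data.Empty using (⊥-elim)
open import Data.Product using (∃; ∃-syntax; _×_; _,_; proj₁; proj₂; swap)
open import Data.Sum using (_⊎_; inj₁; inj₂)
open import Data.Nat using (ℕ; zero; suc; _+_; _*_; _^_; _≤_; _<_; z≤n; s≤s; _≤?_; _<?_)
open import Data.Nat.Properties
  using (≮⇒≥; ≰⇒>; +-cancelˡ-<; +-monoˡ-≤; +-identityʳ; <-≤-trans; ≤-<-trans; <-irrefl;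
         +-suc; m^n>0; m⊔n≤o⇒m≤o; m⊔n≤o⇒n≤o)
open import Data.Fin using (Fin; zero; suc)
open import Data.Fin.Subset using (Subset; _∪_; _∩_; ∁; ⊤) renaming (⊥ to ∅)
open import Data.Fin.Subset.Properties
  using (_⊆?_; anySubset?; p∩q⊆q; ∩-identityʳ; ∪-inverseʳ; ∩-distribˡ-∪)
open import Data.Bool using (T; T?)
open import Data.Vec using (Vec; lookup; zipWith; []; _∷_)
open import Data.Vec.Properties using (map-∘)
import Data.Vec as Vec
import Data.Vec.Relation.Unary.All as VecAll
open import Data.Vec.Relation.Unary.All using ([]; _∷_)
open import Data.Vec.Relation.Unary.AllPairs using ([]; _∷_)
import Data.Vec.Relation.Unary.Unique.Setoid as VecUnique
open import Data.Vec.Relation.Unary.Unique.Setoid.Properties using (lookup-injective)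
open import Data.List using (List; []; _∷_; length; map)
open import Data.List.Properties using (length-map; length-tabulate)
open import Data.List.Relation.Unary.All using (All; []; _∷_)
import Data.List.Relation.Unary.All as All
open import Data.List.Relation.Unary.Any using (Any; here; there)
import Data.List.Relation.Unary.Any as Any
import Data.List.Relation.Unary.Any.Properties as Any
open import Data.List.Relation.Unary.AllPairs using (AllPairs; []; _∷_)
import Data.List.Relation.Unary.AllPairs.Properties as AllPairs
open import Data.List.Relation.Binary.Sublist.Propositional using (_⊆_; []; _∷_; _∷ʳ_)
open import Data.List.Relation.Binary.Sublist.Propositional.Properties
  using (All-resp-⊆; Any-resp-⊆)
open import Relation.Nullary using (¬_; Dec; yes; no; contraposition)
open import Relation.Nullary.Negation using (negated-stable; ¬¬-map)
open import Relation.Nullary.Decidable using (_×-dec_; ¬?; decidable-stable; ¬¬-excluded-middle)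
open import Relation.Unary using (Pred)
open import Relation.Binary using (Setoid)
open import Relation.Binary.PropositionalEquality
  using (_≡_; _≢_; refl; sym; trans; cong; subst; module ≡-Reasoning)

private
  variable
    a b p r : Level
    A : Set a
    B : Set b

infixl 1 _>>=_

_>>=_ : ¬ ¬ A → (A → ¬ ¬ B) → ¬ ¬ B
m >>= f = negated-stable (¬¬-map f m)

return : A → ¬ ¬ A
return x ¬x = ¬x x

¬¬-→ : (A → ¬ ¬ B) → ¬ ¬ (A → B)
¬¬-→ f ¬f = ¬f (λ x → ⊥-elim (f x (λ y → ¬f (λ _ → y))))

¬¬-Π-Fin : ∀ {k} {P : Fin k → Set p} → (∀ i → ¬ ¬ P i) → ¬ ¬ (∀ i → P i)
¬¬-Π-Fin {k = zero}  _   = return λ ()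
¬¬-Π-Fin {k = suc k} ¬¬P = do
  P₀ ← ¬¬P zero
  Pₛ ← ¬¬-Π-Fin (¬¬P ∘ suc)
  return λ { zero → P₀ ; (suc i) → Pₛ i }

¬¬-pairwise : ∀ {k} {R : Fin k → Fin k → Set r} →
              (∀ i j → i ≢ j → ¬ ¬ R i j) → ¬ ¬ (∀ i j → i ≢ j → R i j)
¬¬-pairwise ¬¬R = ¬¬-Π-Fin λ i → ¬¬-Π-Fin λ j → ¬¬-→ (¬¬R i j)

¬¬-partition : (Q : Pred A p) (xs : List A) →
  ¬ ¬ (∃[ ys ] ∃[ zs ] ys ⊆ xs × zs ⊆ xs × All Q ys × All (¬_ ∘ Q) zs ×
                        length ys + length zs ≡ length xs)
¬¬-partition Q [] = return ([] , [] , [] , [] , [] , [] , refl)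
¬¬-partition Q (x ∷ xs) = do
  (ys , zs , ys⊆ , zs⊆ , Qys , ¬Qzs , len) ← ¬¬-partition Q xs
  Q? ← ¬¬-excluded-middle
  return (insert Q? ys zs ys⊆ zs⊆ Qys ¬Qzs len)
  where
  insert : Dec (Q x) → ∀ ys zs → ys ⊆ xs → zs ⊆ xs → All Q ys → All (¬_ ∘ Q) zs →
         length ys + length zs ≡ length xs →
         ∃[ ys ] ∃[ zs ] ys ⊆ x ∷ xs × zs ⊆ x ∷ xs × All Q ys × All (¬_ ∘ Q) zs ×
                         length ys + length zs ≡ suc (length xs)
  insert (yes Qx) ys zs ys⊆ zs⊆ Qys ¬Qzs len =
    x ∷ ys , zs , refl ∷ ys⊆ , x ∷ʳ zs⊆ , Qx ∷ Qys , ¬Qzs , cong suc len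
  insert (no ¬Qx) ys zs ys⊆ zs⊆ Qys ¬Qzs len =
    ys , x ∷ zs , x ∷ʳ ys⊆ , refl ∷ zs⊆ , Qys , ¬Qx ∷ ¬Qzs ,
    trans (+-suc (length ys) (length zs)) (cong suc len)

module _ {A : Set a} {R : A → A → Set r} where

  AllPairs-resp-⊆ : ∀ {xs ys} → xs ⊆ ys → AllPairs R ys → AllPairs R xs
  AllPairs-resp-⊆ []         []         = []
  AllPairs-resp-⊆ (y ∷ʳ xs⊆) (_  ∷ Rys) = AllPairs-resp-⊆ xs⊆ Rys
  AllPairs-resp-⊆ (refl ∷ xs⊆) (Ry ∷ Rys) = All-resp-⊆ xs⊆ Ry ∷ AllPairs-resp-⊆ xs⊆ Rys

  AllPairs-mapWithAll : {S : Pred A p} {R′ : A → A → Set r} →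
                        (∀ {x y} → S x → S y → R x y → R′ x y) →
                        ∀ {xs} → All S xs → AllPairs R xs → AllPairs R′ xs
  AllPairs-mapWithAll f []         []         = []
  AllPairs-mapWithAll f (Sx ∷ Sxs) (Rx ∷ Rxs) =
    All.zipWith (λ (Sy , Rxy) → f Sx Sy Rxy) (Sxs , Rx) ∷ AllPairs-mapWithAll f Sxs Rxs

+-pigeonhole : ∀ k m n → 2 * k < m + n → k < m ⊎ k < n
+-pigeonhole k m n 2k<m+n with k <? m
... | yes k<m = inj₁ k<m
... | no  k≮m = inj₂ (subst (_< n) (+-identityʳ k)
                        (+-cancelˡ-< k (k + 0) n (<-≤-trans 2k<m+n (+-monoˡ-≤ n (≮⇒≥ k≮m)))))

module ClassCounting {a ℓ} (𝕊 : Setoid a ℓ) where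

  open Setoid 𝕊 using (Carrier; _≈_; _≉_) renaming (sym to ≈-sym; trans to ≈-trans)
  open VecUnique 𝕊 using (Unique)

  Meets : Pred Carrier ℓ → Carrier → Set (a ⊔ ℓ)
  Meets P x = ∃[ y ] P y × x ≈ y

  _≲_ : Pred Carrier ℓ → Pred Carrier ℓ → Set (a ⊔ ℓ)
  P ≲ Q = ∀ {x} → P x → ¬ ¬ Meets Q x

  SameClasses : Pred Carrier ℓ → Pred Carrier ℓ → Set (a ⊔ ℓ)
  SameClasses P Q = P ≲ Q × Q ≲ P

  Separated : List (Pred Carrier ℓ) → Set (a ⊔ lsuc ℓ)
  Separated = AllPairs (λ P Q → ¬ SameClasses P Q)

  InUnion : List (Pred Carrier ℓ) → Carrier → Set (a ⊔ lsuc ℓ)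
  InUnion Ps x = Any (λ P → P x) Ps

  deleteClass : Carrier → Pred Carrier ℓ → Pred Carrier ℓ
  deleteClass x P y = P y × x ≉ y

  separated⇒nonempty : ∀ {Ps} → Separated Ps → 1 < length Ps → ¬ ¬ ∃ (InUnion Ps)
  separated⇒nonempty {P ∷ Q ∷ _} ((P≭Q ∷ _) ∷ _) _ ∄ =
    P≭Q ((λ Px → ⊥-elim (∄ (_ , here Px))) , (λ Qy → ⊥-elim (∄ (_ , there (here Qy)))))
  separated⇒nonempty {_ ∷ []} _ (s≤s ())
  separated⇒nonempty {[]}     _ ()

  ≲-deleteClass⁻ : ∀ {x P Q} → (Meets P x → ¬ ¬ Meets Q x) →
                   deleteClass x P ≲ deleteClass x Q → P ≲ Q
  ≲-deleteClass⁻ {x} meets P∖≲Q∖ {y} Py = do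
    no x≉y ← ¬¬-excluded-middle
      where yes x≈y → do
              (z , Qz , x≈z) ← meets (y , Py , x≈y)
              return (z , Qz , ≈-trans (≈-sym x≈y) x≈z)
    (z , (Qz , _) , y≈z) ← P∖≲Q∖ (Py , x≉y)
    return (z , Qz , y≈z)

  deleteClass-separated : ∀ {x} {S : Pred (Pred Carrier ℓ) p} →
                          (∀ {P Q} → S P → S Q → Meets P x → ¬ ¬ Meets Q x) →
                          ∀ {Ps} → All S Ps → Separated Ps → Separated (map (deleteClass x) Ps)
  deleteClass-separated agree SPs sep = AllPairs.map⁺ (AllPairs-mapWithAll
    (λ SP SQ P≭Q (P∖≲Q∖ , Q∖≲P∖) →
      P≭Q (≲-deleteClass⁻ (agree SP SQ) P∖≲Q∖ , ≲-deleteClass⁻ (agree SQ SP) Q∖≲P∖))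
    SPs sep)

  InUnion-deleteClass : ∀ {x y Hs Ps} → Hs ⊆ Ps → InUnion (map (deleteClass x) Hs) y →
                        InUnion Ps y × x ≉ y
  InUnion-deleteClass Hs⊆Ps y∈ =
    Any-resp-⊆ Hs⊆Ps (Any.map proj₁ y∈Hs) , proj₂ (proj₂ (Any.satisfied y∈Hs))
    where y∈Hs = Any.map⁻ y∈

  -- The members meeting the class of x, and those avoiding it, each stay separated after
  -- that class is deleted, and one of the two groups has at least half of the members.
  largeSideWithoutClass : ∀ n x {Ps} → Separated Ps → 2 ^ suc n < length Ps →
    ¬ ¬ (∃[ Hs ] Hs ⊆ Ps × Separated (map (deleteClass x) Hs) ×
                  2 ^ n < length (map (deleteClass x) Hs))
  largeSideWithoutClass n x {Ps} sep big = do
    (Ns , Fs , Ns⊆ , Fs⊆ , near , far , len) ← ¬¬-partition (λ P → Meets P x) Ps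
    let half = +-pigeonhole (2 ^ n) (length Ns) (length Fs) (subst (2 ^ suc n <_) (sym len) big)
    return (case half of λ where
      (inj₁ big′) → Ns , Ns⊆ ,
        deleteClass-separated (λ _ x∈Q _ → return x∈Q) near (AllPairs-resp-⊆ Ns⊆ sep) ,
        subst (2 ^ n <_) (sym (length-map _ Ns)) big′
      (inj₂ big′) → Fs , Fs⊆ ,
        deleteClass-separated (λ x∉P _ x∈P → ⊥-elim (x∉P x∈P)) far (AllPairs-resp-⊆ Fs⊆ sep) ,
        subst (2 ^ n <_) (sym (length-map _ Fs)) big′)

  inequivalentElements : ∀ n {Ps} → Separated Ps → 2 ^ n < length Ps →
    ¬ ¬ (∃[ xs ] Unique {suc n} xs × VecAll.All (InUnion Ps) xs)
  inequivalentElements zero sep big = do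
    (x , x∈) ← separated⇒nonempty sep big
    return (x ∷ [] , [] ∷ [] , x∈ ∷ [])
  inequivalentElements (suc n) sep big = do
    (x , x∈) ← separated⇒nonempty sep (≤-<-trans (m^n>0 2 (suc n)) big)
    (Hs , Hs⊆ , sep′ , big′) ← largeSideWithoutClass n x sep big
    (xs , unique , xs∈) ← inequivalentElements n sep′ big′
    return ( x ∷ xs
           , VecAll.map (proj₂ ∘ InUnion-deleteClass Hs⊆) xs∈ ∷ unique
           , x∈ ∷ VecAll.map (proj₁ ∘ InUnion-deleteClass Hs⊆) xs∈ )

  separated≤2^ : ∀ N → (∀ k (g : Fin k → Carrier) → (∀ i j → i ≢ j → g i ≉ g j) → k ≤ N) →
                 ∀ k (Ps : Fin k → Pred Carrier ℓ) →
                 (∀ i j → i ≢ j → ¬ SameClasses (Ps i) (Ps j)) → k ≤ 2 ^ N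
  separated≤2^ N classes≤N k Ps sep = decidable-stable (k ≤? 2 ^ N) λ k≰2^N →
    inequivalentElements N (AllPairs.tabulate⁺ (λ {i} {j} → sep i j))
      (subst (2 ^ N <_) (sym (length-tabulate Ps)) (≰⇒> k≰2^N))
      λ (xs , unique , _) → <-irrefl refl
        (classes≤N (suc N) (lookup xs) (λ i j → contraposition (lookup-injective 𝕊 unique i j)))

module _ {σ : Signature} (𝔄 : MSOStructure σ) where

  Sat? : ∀ {m} (φ : Formula σ m) ρ → Dec (Sat 𝔄 φ ρ)
  Sat? (atom i xs) ρ = T? _
  Sat? (incl x y)  ρ = lookup ρ x ⊆? lookup ρ y
  Sat? (¬' φ)      ρ = ¬? (Sat? φ ρ)
  Sat? (φ ∧' ψ)    ρ = Sat? φ ρ ×-dec Sat? ψ ρ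
  Sat? (∃' φ)      ρ = anySubset? (λ Z → Sat? φ (Z ∷ ρ))

  tp? : ∀ {m} d ρ (φ : Formula σ m) → Dec (tp 𝔄 d ρ φ)
  tp? d ρ φ = (qd φ ≤? d) ×-dec Sat? φ ρ

  Sat-atom-weaken : ∀ {m} Z (ρ : Vec (Subset (size 𝔄)) m) i xs →
                    Sat 𝔄 (atom i (Vec.map suc xs)) (Z ∷ ρ) ≡ Sat 𝔄 (atom i xs) ρ
  Sat-atom-weaken Z ρ i xs = cong (T ∘ rel 𝔄 i) (sym (map-∘ (lookup (Z ∷ ρ)) suc xs))

module _ {σ : Signature} {m : ℕ} where

  ≐-refl : {P : Formula σ m → Set} → P ≐ P
  ≐-refl φ = id , id

  ≐-sym : {P Q : Formula σ m → Set} → P ≐ Q → Q ≐ P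
  ≐-sym P≐Q φ = swap (P≐Q φ)

  ≐-trans : {P Q R : Formula σ m → Set} → P ≐ Q → Q ≐ R → P ≐ R
  ≐-trans P≐Q Q≐R φ = proj₁ (Q≐R φ) ∘ proj₁ (P≐Q φ) , proj₂ (P≐Q φ) ∘ proj₂ (Q≐R φ)

  ≐-stable : {P Q : Formula σ m → Set} → (∀ φ → Dec (P φ)) → (∀ φ → Dec (Q φ)) →
             ¬ ¬ (P ≐ Q) → P ≐ Q
  ≐-stable P? Q? ¬¬P≐Q φ =
    (λ Pφ → decidable-stable (Q? φ) (¬¬-map (λ P≐Q → proj₁ (P≐Q φ) Pφ) ¬¬P≐Q)) ,
    (λ Qφ → decidable-stable (P? φ) (¬¬-map (λ P≐Q → proj₂ (P≐Q φ) Qφ) ¬¬P≐Q))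

p∩q∪p∩∁q≡p : ∀ {n} (p q : Subset n) → (p ∩ q) ∪ (p ∩ ∁ q) ≡ p
p∩q∪p∩∁q≡p p q = begin
  (p ∩ q) ∪ (p ∩ ∁ q) ≡⟨ ∩-distribˡ-∪ p q (∁ q) ⟨
  p ∩ (q ∪ ∁ q)       ≡⟨ cong (p ∩_) (∪-inverseʳ q) ⟩
  p ∩ ⊤               ≡⟨ ∩-identityʳ p ⟩
  p                   ∎
  where open ≡-Reasoning

module Rows {σ : Signature} (𝔄 : MSOStructure σ) (X : Subset (size 𝔄)) where

  SameRow : ∀ d m → Row 𝔄 X m → Row 𝔄 X m → Set
  SameRow d m r r′ = ∀ c → entry 𝔄 X d m r c ≐ entry 𝔄 X d m r′ c

  rowSetoid : ℕ → ℕ → Setoid 0ℓ 0ℓ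
  rowSetoid d m = record
    { Carrier       = Row 𝔄 X m
    ; _≈_           = SameRow d m
    ; isEquivalence = record
      { refl  = λ c → ≐-refl
      ; sym   = λ r≈r′ c → ≐-sym (r≈r′ c)
      ; trans = λ r≈r′ r′≈r″ c → ≐-trans (r≈r′ c) (r′≈r″ c)
      }
    }

  ¬SameRow⇒¬¬DistinctRows : ∀ {d m r r′} → ¬ SameRow d m r r′ → ¬ ¬ DistinctRows 𝔄 X d m r r′
  ¬SameRow⇒¬¬DistinctRows {d} r≉r′ ¬distinct =
    r≉r′ λ c → ≐-stable (tp? 𝔄 d _) (tp? 𝔄 d _) (λ ¬≐ → ¬distinct (c , ¬≐))

  rowClasses≤ : ∀ {d m N} → AtMostDistinctRows 𝔄 X d m N →
                ∀ k (g : Fin k → Row 𝔄 X m) → (∀ i j → i ≢ j → ¬ SameRow d m (g i) (g j)) → k ≤ N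
  rowClasses≤ {d} {N = N} atMost k g inequivalent = decidable-stable (k ≤? N) do
    distinct ← ¬¬-pairwise λ i j i≢j →
      ¬SameRow⇒¬¬DistinctRows {d} {r = g i} {g j} (inequivalent i j i≢j)
    return (atMost k g distinct)

  record _Extends_ {m} (u : Row 𝔄 X (suc m)) (r : Row 𝔄 X m) : Set where
    constructor extends
    field tail≡ : Vec.tail (proj₁ u) ≡ proj₁ r

  glue : ∀ {m} → Row 𝔄 X m → Col 𝔄 X m → Vec (Subset (size 𝔄)) m
  glue r c = zipWith _∪_ (proj₁ r) (proj₁ c)

  module _ {d m : ℕ} where

    open ClassCounting (rowSetoid d (suc m)) using (_≲_; SameClasses)

    ∃-transfer : ∀ {r r′} → (_Extends r) ≲ (_Extends r′) → ∀ c φ → qd φ ≤ d →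
                 Sat 𝔄 (∃' φ) (glue r c) → Sat 𝔄 (∃' φ) (glue r′ c)
    ∃-transfer {r} {r′} ext≲ c φ φ≤d (Z , Zφ) = decidable-stable (Sat? 𝔄 (∃' φ) (glue r′ c)) do
      ((Z′ ∷ _ , _) , extends refl , u≈u′) ← ext≲ {u} (extends refl)
      return (Z′ ∪ (Z ∩ ∁ X) , proj₂ (proj₁ (u≈u′ c′ φ) (φ≤d , Zφ′)))
      where
      u : Row 𝔄 X (suc m)
      u = Z ∩ X ∷ proj₁ r , (λ {x} → p∩q⊆q Z X {x}) ∷ proj₂ r
      c′ : Col 𝔄 X (suc m)
      c′ = Z ∩ ∁ X ∷ proj₁ c , (λ {x} → p∩q⊆q Z (∁ X) {x}) ∷ proj₂ c
      Zφ′ : Sat 𝔄 φ (glue u c′)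
      Zφ′ = subst (λ W → Sat 𝔄 φ (W ∷ glue r c)) (sym (p∩q∪p∩∁q≡p Z X)) Zφ

    -- Atomic formulas are padded with a vacuous quantifier to reach the existential case.
    transfer : ∀ {r r′} → SameClasses (_Extends r) (_Extends r′) → ∀ c ψ → qd ψ ≤ suc d →
               Sat 𝔄 ψ (glue r c) → Sat 𝔄 ψ (glue r′ c)
    transfer same c (atom i xs) _ ψ-holds =
      let (Z′ , ψ-holds′) = ∃-transfer (proj₁ same) c (atom i (Vec.map suc xs)) z≤n
                              (∅ , subst id (sym (Sat-atom-weaken 𝔄 ∅ _ i xs)) ψ-holds)
      in subst id (Sat-atom-weaken 𝔄 Z′ _ i xs) ψ-holds′
    transfer same c (incl x y) _ ψ-holds =
      proj₂ (∃-transfer (proj₁ same) c (incl (suc x) (suc y)) z≤n (∅ , ψ-holds))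
    transfer same c (¬' ψ) ψ≤ ¬ψ-holds ψ-holds′ = ¬ψ-holds (transfer (swap same) c ψ ψ≤ ψ-holds′)
    transfer same c (φ ∧' ψ) φ∧ψ≤ (φ-holds , ψ-holds) =
      transfer same c φ (m⊔n≤o⇒m≤o (qd φ) (qd ψ) φ∧ψ≤) φ-holds ,
      transfer same c ψ (m⊔n≤o⇒n≤o (qd φ) (qd ψ) φ∧ψ≤) ψ-holds
    transfer same c (∃' φ) (s≤s φ≤d) = ∃-transfer (proj₁ same) c φ φ≤d

    sameClasses⇒SameRow : ∀ {r r′} → SameClasses (_Extends r) (_Extends r′) →
                          SameRow (suc d) m r r′
    sameClasses⇒SameRow same c ψ =
      (λ (ψ≤ , ψ-holds) → ψ≤ , transfer same c ψ ψ≤ ψ-holds) ,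
      (λ (ψ≤ , ψ-holds) → ψ≤ , transfer (swap same) c ψ ψ≤ ψ-holds)

lemmaA4 : (σ : Signature) (𝔄 : MSOStructure σ) (X : Subset (size 𝔄)) (d m N : ℕ) →
          AtMostDistinctRows 𝔄 X d (suc m) N →
          AtMostDistinctRows 𝔄 X (suc d) m (2 ^ N)
lemmaA4 σ 𝔄 X d m N atMostN k f distinct =
  separated≤2^ N (rowClasses≤ atMostN) k (λ i → _Extends f i) separated
  where
  open Rows 𝔄 X
  open ClassCounting (rowSetoid d (suc m)) using (SameClasses; separated≤2^)

  separated : ∀ i j → i ≢ j → ¬ SameClasses (_Extends f i) (_Extends f j)
  separated i j i≢j same = let (c , ≢) = distinct i j i≢j in ≢ (sameClasses⇒SameRow same c)
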